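{- The set $\operatorname{PD}(2,1)$ of all pairs $(n,k)$ of positive integers for which there exists a projective $2$-divisible binary linear $[n,k]$ code consists exactly of all pairs $(n,k)$ of positive integers satisfying $k+1\leq n\leq 2^k-1$ and $n\notin\{2^k-3,2^k-2\}$.
   Context: A binary linear $[n,k]$ code is a $k$-dimensional subspace of $\mathbb{F}_2^n$. It is $2$-divisible if every codeword has even Hamming weight. It is projective if the columns of a generating matrix are nonzero and pairwise distinct (equivalently, the dual code has minimum distance at least $3$). -}

module Defs where

open import Data.Bool using (Bool; true; false; _∧_; _xor_)
open import Data.Nat using (ℕ; zero; suc; _+_)
open import Data.Nat.Divisibility using (_∣_)
open import Data.Fin using (Fin)
open import Data.Vec using (Vec; []; _∷_; tabulate; lookup; map; zipWith; foldr; replicate)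
open import Data.Product using (Σ; _×_)
open import Relation.Binary.PropositionalEquality using (_≡_; _≢_)

-- Elements of F₂ are represented by Bool (false = 0, true = 1),
-- addition is _xor_, multiplication is _∧_.

weight : ∀ {n} → Vec Bool n → ℕ
weight [] = 0
weight (false ∷ v) = weight v
weight (true ∷ v) = suc (weight v)

GenMatrix : ℕ → ℕ → Set
GenMatrix n k = Vec (Vec Bool n) k

column : ∀ {n k} → GenMatrix n k → Fin n → Vec Bool k
column G j = map (λ row → lookup row j) G

encode : ∀ {n k} → GenMatrix n k → Vec Bool k → Vec Bool n
encode G m = tabulate (λ j → foldr _ _xor_ false (zipWith _∧_ m (column G j)))

-- Rows of G are linearly independent over F₂, i.e. the code generated by G
-- (the row space) has dimension k.
FullRank : ∀ {n k} → GenMatrix n k → Set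
FullRank {n} {k} G = ∀ m → encode G m ≡ replicate n false → m ≡ replicate k false

Projective : ∀ {n k} → GenMatrix n k → Set
Projective {n} {k} G =
  (∀ j → column G j ≢ replicate k false) × (∀ i j → i ≢ j → column G i ≢ column G j)

TwoDivisible : ∀ {n k} → GenMatrix n k → Set
TwoDivisible G = ∀ m → 2 ∣ weight (encode G m)

ExistsPD : ℕ → ℕ → Set
ExistsPD n k = Σ (GenMatrix n k) (λ G → FullRank G × Projective G × TwoDivisible G)

-- The weight of the codeword m·G is the number of columns c with m · c = 1, so its parity is
-- m · (sum of the columns): G is 2-divisible exactly when its columns sum to zero.  Hence a
-- projective 2-divisible [n,k] code is the same thing as a spanning set of n nonzero points of
-- F₂ᵏ with zero sum.
--
-- Necessity.  An even-weight codeword is determined by all of its coordinates but one, which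
-- gives k + 1 ≤ n.  For k ≥ 2 the whole of F₂ᵏ sums to zero, so the 2ᵏ − 1 − n nonzero points
-- that are not columns also sum to zero; but one nonzero point, or two distinct points, never
-- sum to zero.
--
-- Sufficiency.  Split F₂ᵏ⁺¹ as {0} × F₂ᵏ ∪ {1} × F₂ᵏ.  The set {0} × P ∪ {1} × Q sums to zero iff
-- |Q| is even and P and Q have the same sum, and it spans if P spans and Q is nonempty.  For P
-- take the unit vectors (sum 1ᵛ), the unit vectors and 1ᵛ (sum 0ᵛ), all nonzero points (sum 0ᵛ)
-- or all nonzero points but 1ᵛ (sum 1ᵛ); it remains to find subsets Q of F₂ᵏ of a given size
-- with sum 0ᵛ or 1ᵛ.  They exist for every size (except 2 and 2ᵏ − 2 when the sum is 0ᵛ): by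
-- induction on k up to size 2ᵏ⁻¹, and by complementation above.  Only n = k + 3 escapes this
-- scheme and is built by hand.

module Submission where

open import Defs
open import Algebra using (CommutativeRing)
open import Data.Bool using (Bool; true; false; _∧_; _∨_; _xor_; not)
open import Data.Bool.Properties
  using (∧-zeroʳ; ∧-identityʳ; ∧-comm; ∧-conicalˡ; ∧-distribˡ-xor; ∧-distribʳ-∨; ∨-zeroʳ; ∨-inverseˡ;
         xor-same; xor-identityʳ; xor-comm; not-involutive; not-distribˡ-xor; not-¬; ¬-not; xor-∧-commutativeRing)
  renaming (_≟_ to _≟ᵇ_)
open import Data.Nat using (ℕ; zero; suc; _+_; _*_; _∸_; _^_; _≤_; _<_; z≤n; s≤s; _≤?_)
open import Data.Nat.Properties
open import Data.Nat.Divisibility using (_∣_; divides)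
open import Data.Fin using (Fin; zero; suc)
open import Data.Fin.Properties as Fin using ()
open import Data.Vec using (Vec; []; _∷_; _++_; head; replicate; zipWith; foldr; tabulate; lookup; map; tail)
open import Data.Vec.Properties
  using (≡-dec; ∷-injectiveʳ; lookup-map; lookup∘tabulate; tabulate∘lookup; tabulate-cong; lookup-replicate)
open import Data.Product using (Σ; ∃; _×_; _,_; proj₁; proj₂)
open import Data.Sum using (_⊎_; inj₁; inj₂)
open import Data.Empty using (⊥-elim)
open import Function using (_∘_; case_of_)
open import Function.Bundles using (_⇔_; mk⇔; Equivalence)
open import Relation.Nullary using (yes; no)
open import Data.Vec.Membership.Propositional using (_∈_)
open import Data.Vec.Membership.Propositional.Properties using (∈-map⁺; ∈-++⁺ˡ; ∈-++⁺ʳ)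
open import Data.Vec.Relation.Unary.All as All using (All; []; _∷_)
import Data.Vec.Relation.Unary.All.Properties as All
open import Data.Vec.Relation.Unary.Any using (here; index)
open import Data.Vec.Relation.Unary.Any.Properties using (lookup-index)
open import Data.Vec.Relation.Unary.AllPairs using ([]; _∷_)
import Data.Vec.Relation.Unary.AllPairs.Properties as AllPairs
open import Data.Vec.Relation.Unary.Unique.Propositional using (Unique)
import Data.Vec.Relation.Unary.Unique.Propositional.Properties as Unique
open import Relation.Binary.PropositionalEquality
open import Data.Nat.Tactic.RingSolver using (solve-∀)

open import Algebra.Properties.CommutativeSemigroup
  (CommutativeRing.+-commutativeSemigroup xor-∧-commutativeRing) using () renaming (interchange to xor-interchange)
open import Algebra.Properties.CommutativeSemigroup +-commutativeSemigroup
  using () renaming (interchange to +-interchange)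

toℕ : Bool → ℕ
toℕ false = 0
toℕ true  = 1

toℕ≤1 : ∀ b → toℕ b ≤ 1
toℕ≤1 false = z≤n
toℕ≤1 true  = s≤s z≤n

odd : ℕ → Bool
odd zero    = false
odd (suc n) = not (odd n)

odd-+ : ∀ m n → odd (m + n) ≡ odd m xor odd n
odd-+ zero    n = refl
odd-+ (suc m) n = trans (cong not (odd-+ m n)) (not-distribˡ-xor (odd m) (odd n))

odd-double : ∀ n → odd (n + n) ≡ false
odd-double n = trans (odd-+ n n) (xor-same (odd n))

2^suc : ∀ k → 2 ^ suc k ≡ 2 ^ k + 2 ^ k
2^suc k = cong (2 ^ k +_) (+-identityʳ (2 ^ k))

odd-2^suc : ∀ k → odd (2 ^ suc k) ≡ false
odd-2^suc k = trans (cong odd (2^suc k)) (odd-double (2 ^ k))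

odd-2+ : ∀ n → odd (2 + n) ≡ odd n
odd-2+ n = not-involutive (odd n)

2∣⇒¬odd : ∀ {n} → 2 ∣ n → odd n ≡ false
2∣⇒¬odd (divides q refl) = ¬odd[q*2] q
  where
  ¬odd[q*2] : ∀ q → odd (q * 2) ≡ false
  ¬odd[q*2] zero    = refl
  ¬odd[q*2] (suc q) = trans (not-involutive _) (¬odd[q*2] q)

¬odd⇒2∣ : ∀ n → odd n ≡ false → 2 ∣ n
¬odd⇒2∣ zero          _ = divides 0 refl
¬odd⇒2∣ (suc zero)    ()
¬odd⇒2∣ (suc (suc n)) e with ¬odd⇒2∣ n (trans (sym (not-involutive (odd n))) e)
... | divides q n≡q*2 = divides (suc q) (cong (2 +_) n≡q*2)

even-split-2 : ∀ a b → a + b ≡ 2 → odd b ≡ false → (a ≡ 2 × b ≡ 0) ⊎ (a ≡ 0 × b ≡ 2)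
even-split-2 2 0 _ _ = inj₁ (refl , refl)
even-split-2 0 2 _ _ = inj₂ (refl , refl)
even-split-2 1 1 _ ()
even-split-2 0 0 () _
even-split-2 0 1 () _
even-split-2 0 (suc (suc (suc _))) () _
even-split-2 1 0 () _
even-split-2 1 (suc (suc _)) () _
even-split-2 2 (suc _) () _
even-split-2 (suc (suc (suc _))) _ () _

≤⇒+ : ∀ {m n} → m ≤ n → ∃ λ d → m + d ≡ n
≤⇒+ {m} {n} m≤n = n ∸ m , m+[n∸m]≡n m≤n

mirror : ∀ {M q} → M < q → q ≤ M + M → Σ ℕ λ q′ → q′ < M × q′ + q ≡ M + M
mirror {M} {q} M<q q≤2M = M + M ∸ q , +-cancelʳ-< q _ M (subst (_< M + q) (sym q′+q≡2M) (+-monoʳ-< M M<q)) , q′+q≡2M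
  where q′+q≡2M = m∸n+n≡m q≤2M

<⇒≤∸1 : ∀ {n m} → n < m → n ≤ m ∸ 1
<⇒≤∸1 {n} {m} n<m = m+n≤o⇒m≤o∸n n (subst (_≤ m) (+-comm 1 n) n<m)

≤∸1⇒< : ∀ {n m} → 1 ≤ m → n ≤ m ∸ 1 → n < m
≤∸1⇒< {n} {m} 1≤m n≤m∸1 = subst (_≤ m) (+-comm n 1) (m≤o∸n⇒m+n≤o n 1≤m n≤m∸1)

≢∸⇒+≢ : ∀ {n m c} → n ≢ m ∸ c → c + n ≢ m
≢∸⇒+≢ {n} {c = c} n≢m∸c c+n≡m = n≢m∸c (trans (sym (m+n∸m≡n c n)) (cong (_∸ c) c+n≡m))

+≢⇒≢∸ : ∀ {n m c} → c ≤ m → c + n ≢ m → n ≢ m ∸ c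
+≢⇒≢∸ {c = c} c≤m c+n≢m n≡m∸c = c+n≢m (trans (cong (c +_) n≡m∸c) (m+[n∸m]≡n c≤m))

infixl 6 _⊕_
infix  7 _·_
infix  4 _==_

0ᵛ : ∀ {k} → Vec Bool k
0ᵛ = replicate _ false

1ᵛ : ∀ {k} → Vec Bool k
1ᵛ = replicate _ true

_⊕_ : ∀ {k} → Vec Bool k → Vec Bool k → Vec Bool k
_⊕_ = zipWith _xor_

_·_ : ∀ {k} → Vec Bool k → Vec Bool k → Bool
m · x = foldr (λ _ → Bool) _xor_ false (zipWith _∧_ m x)

_==_ : ∀ {k} → Vec Bool k → Vec Bool k → Bool
[]      == []      = true
(a ∷ x) == (b ∷ y) = not (a xor b) ∧ (x == y)

⊕-identityˡ : ∀ {k} (x : Vec Bool k) → 0ᵛ ⊕ x ≡ x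
⊕-identityˡ []      = refl
⊕-identityˡ (a ∷ x) = cong (a ∷_) (⊕-identityˡ x)

⊕-identityʳ : ∀ {k} (x : Vec Bool k) → x ⊕ 0ᵛ ≡ x
⊕-identityʳ []      = refl
⊕-identityʳ (a ∷ x) = cong₂ _∷_ (xor-identityʳ a) (⊕-identityʳ x)

⊕-self : ∀ {k} (x : Vec Bool k) → x ⊕ x ≡ 0ᵛ
⊕-self []      = refl
⊕-self (a ∷ x) = cong₂ _∷_ (xor-same a) (⊕-self x)

⊕-interchange : ∀ {k} (a b c d : Vec Bool k) → (a ⊕ b) ⊕ (c ⊕ d) ≡ (a ⊕ c) ⊕ (b ⊕ d)
⊕-interchange []       []       []       []       = refl
⊕-interchange (a ∷ as) (b ∷ bs) (c ∷ cs) (d ∷ ds) =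
  cong₂ _∷_ (xor-interchange a b c d) (⊕-interchange as bs cs ds)

⊕≡0ᵛ⇒≡ : ∀ {k} (x y : Vec Bool k) → x ⊕ y ≡ 0ᵛ → x ≡ y
⊕≡0ᵛ⇒≡ []      []      _ = refl
⊕≡0ᵛ⇒≡ (a ∷ x) (b ∷ y) e = cong₂ _∷_ (bit a b (cong head e)) (⊕≡0ᵛ⇒≡ x y (∷-injectiveʳ e))
  where
  bit : ∀ a b → a xor b ≡ false → a ≡ b
  bit false false _ = refl
  bit true  true  _ = refl

·-zeroˡ : ∀ {k} (x : Vec Bool k) → 0ᵛ · x ≡ false
·-zeroˡ []      = refl
·-zeroˡ (_ ∷ x) = ·-zeroˡ x

·-comm : ∀ {k} (m x : Vec Bool k) → m · x ≡ x · m
·-comm []      []      = refl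
·-comm (a ∷ m) (b ∷ x) = cong₂ _xor_ (∧-comm a b) (·-comm m x)

·-zeroʳ : ∀ {k} (m : Vec Bool k) → m · 0ᵛ ≡ false
·-zeroʳ m = trans (·-comm m 0ᵛ) (·-zeroˡ m)

·-distribʳ-⊕ : ∀ {k} (m x y : Vec Bool k) → m · (x ⊕ y) ≡ m · x xor m · y
·-distribʳ-⊕ []      []      []      = refl
·-distribʳ-⊕ (a ∷ m) (b ∷ x) (c ∷ y) = begin
  (a ∧ (b xor c)) xor m · (x ⊕ y)               ≡⟨ cong₂ _xor_ (∧-distribˡ-xor a b c) (·-distribʳ-⊕ m x y) ⟩
  ((a ∧ b) xor (a ∧ c)) xor (m · x xor m · y)   ≡⟨ xor-interchange (a ∧ b) (a ∧ c) (m · x) (m · y) ⟩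
  ((a ∧ b) xor m · x) xor ((a ∧ c) xor m · y)   ∎
  where open ≡-Reasoning

·-distribˡ-⊕ : ∀ {k} (m m′ x : Vec Bool k) → (m ⊕ m′) · x ≡ m · x xor m′ · x
·-distribˡ-⊕ m m′ x = begin
  (m ⊕ m′) · x        ≡⟨ ·-comm (m ⊕ m′) x ⟩
  x · (m ⊕ m′)        ≡⟨ ·-distribʳ-⊕ x m m′ ⟩
  x · m xor x · m′    ≡⟨ cong₂ _xor_ (·-comm x m) (·-comm x m′) ⟩
  m · x xor m′ · x    ∎
  where open ≡-Reasoning

·≡false⇒≡0ᵛ : ∀ {k} (s : Vec Bool k) → (∀ m → m · s ≡ false) → s ≡ 0ᵛ
·≡false⇒≡0ᵛ []      _ = refl
·≡false⇒≡0ᵛ (b ∷ s) h = cong₂ _∷_ b≡false (·≡false⇒≡0ᵛ s (λ m → h (false ∷ m)))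
  where
  b≡false : b ≡ false
  b≡false = trans (sym (trans (cong (b xor_) (·-zeroˡ s)) (xor-identityʳ b))) (h (true ∷ 0ᵛ))

==-refl : ∀ {k} (x : Vec Bool k) → (x == x) ≡ true
==-refl []          = refl
==-refl (false ∷ x) = ==-refl x
==-refl (true ∷ x)  = ==-refl x

==⇒≡ : ∀ {k} {x y : Vec Bool k} → (x == y) ≡ true → x ≡ y
==⇒≡ {x = []}        {[]}        _ = refl
==⇒≡ {x = false ∷ x} {false ∷ y} e = cong (false ∷_) (==⇒≡ e)
==⇒≡ {x = true ∷ x}  {true ∷ y}  e = cong (true ∷_) (==⇒≡ e)

≢⇒==false : ∀ {k} {x y : Vec Bool k} → x ≢ y → (x == y) ≡ false
≢⇒==false {x = x} {y} x≢y with x == y in e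
... | true  = ⊥-elim (x≢y (==⇒≡ e))
... | false = refl

∑ : ∀ k → (Vec Bool k → ℕ) → ℕ
∑ zero    f = f []
∑ (suc k) f = ∑ k (f ∘ (false ∷_)) + ∑ k (f ∘ (true ∷_))

∑-cong : ∀ k {f g : Vec Bool k → ℕ} → f ≗ g → ∑ k f ≡ ∑ k g
∑-cong zero    f≗g = f≗g []
∑-cong (suc k) f≗g = cong₂ _+_ (∑-cong k (f≗g ∘ (false ∷_))) (∑-cong k (f≗g ∘ (true ∷_)))

∑-distrib-+ : ∀ k (f g : Vec Bool k → ℕ) → ∑ k (λ x → f x + g x) ≡ ∑ k f + ∑ k g
∑-distrib-+ zero    f g = refl
∑-distrib-+ (suc k) f g =
  trans (cong₂ _+_ (∑-distrib-+ k (f ∘ (false ∷_)) (g ∘ (false ∷_)))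
                   (∑-distrib-+ k (f ∘ (true ∷_)) (g ∘ (true ∷_))))
        (+-interchange (∑ k (f ∘ (false ∷_))) _ _ _)

∑-mono-≤ : ∀ k {f g : Vec Bool k → ℕ} → (∀ x → f x ≤ g x) → ∑ k f ≤ ∑ k g
∑-mono-≤ zero    f≤g = f≤g []
∑-mono-≤ (suc k) f≤g = +-mono-≤ (∑-mono-≤ k (f≤g ∘ (false ∷_))) (∑-mono-≤ k (f≤g ∘ (true ∷_)))

∑-zero : ∀ k → ∑ k (λ _ → 0) ≡ 0
∑-zero zero    = refl
∑-zero (suc k) = cong₂ _+_ (∑-zero k) (∑-zero k)

∑-one : ∀ k → ∑ k (λ _ → 1) ≡ 2 ^ k
∑-one zero    = refl
∑-one (suc k) = trans (cong₂ _+_ (∑-one k) (∑-one k)) (sym (2^suc k))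

∑-comm : ∀ a b (g : Vec Bool a → Vec Bool b → ℕ) →
         ∑ a (λ x → ∑ b (g x)) ≡ ∑ b (λ y → ∑ a (λ x → g x y))
∑-comm zero    b g = refl
∑-comm (suc a) b g = begin
  ∑ a (λ x → ∑ b (g (false ∷ x))) + ∑ a (λ x → ∑ b (g (true ∷ x)))
    ≡⟨ cong₂ _+_ (∑-comm a b (g ∘ (false ∷_))) (∑-comm a b (g ∘ (true ∷_))) ⟩
  ∑ b (λ y → ∑ a (λ x → g (false ∷ x) y)) + ∑ b (λ y → ∑ a (λ x → g (true ∷ x) y))
    ≡⟨ ∑-distrib-+ b _ _ ⟨
  ∑ b (λ y → ∑ (suc a) (λ x → g x y)) ∎
  where open ≡-Reasoning

∑ᶠ : ∀ n → (Fin n → ℕ) → ℕ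
∑ᶠ zero    f = 0
∑ᶠ (suc n) f = f zero + ∑ᶠ n (f ∘ suc)

∑ᶠ-cong : ∀ n {f g : Fin n → ℕ} → f ≗ g → ∑ᶠ n f ≡ ∑ᶠ n g
∑ᶠ-cong zero    f≗g = refl
∑ᶠ-cong (suc n) f≗g = cong₂ _+_ (f≗g zero) (∑ᶠ-cong n (f≗g ∘ suc))

∑ᶠ-zero : ∀ n {f : Fin n → ℕ} → (∀ j → f j ≡ 0) → ∑ᶠ n f ≡ 0
∑ᶠ-zero zero    _  = refl
∑ᶠ-zero (suc n) f≗0 = cong₂ _+_ (f≗0 zero) (∑ᶠ-zero n (f≗0 ∘ suc))

∑ᶠ-one : ∀ n → ∑ᶠ n (λ _ → 1) ≡ n
∑ᶠ-one zero    = refl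
∑ᶠ-one (suc n) = cong suc (∑ᶠ-one n)

weight-tabulate : ∀ {n} (f : Fin n → Bool) → weight (tabulate f) ≡ ∑ᶠ n (toℕ ∘ f)
weight-tabulate {zero}  f = refl
weight-tabulate {suc n} f with f zero
... | true  = cong suc (weight-tabulate (f ∘ suc))
... | false = weight-tabulate (f ∘ suc)

∑ᶠ-∑-comm : ∀ n k (g : Fin n → Vec Bool k → ℕ) →
            ∑ᶠ n (λ j → ∑ k (g j)) ≡ ∑ k (λ x → ∑ᶠ n (λ j → g j x))
∑ᶠ-∑-comm zero    k g = sym (∑-zero k)
∑ᶠ-∑-comm (suc n) k g =
  trans (cong (∑ k (g zero) +_) (∑ᶠ-∑-comm n k (g ∘ suc))) (sym (∑-distrib-+ k (g zero) _))

Subset : ℕ → Set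
Subset k = Vec Bool k → Bool

∣_∣ : ∀ {k} → Subset k → ℕ
∣_∣ {k} χ = ∑ k (toℕ ∘ χ)

infixr 6 _∪_
infixr 7 _∩_

∅ : ∀ {k} → Subset k
∅ _ = false

full : ∀ {k} → Subset k
full _ = true

⁅_⁆ : ∀ {k} → Vec Bool k → Subset k
⁅ c ⁆ = c ==_

_∪_ : ∀ {k} → Subset k → Subset k → Subset k
(A ∪ C) x = A x ∨ C x

_∩_ : ∀ {k} → Subset k → Subset k → Subset k
(A ∩ C) x = A x ∧ C x

∁ : ∀ {k} → Subset k → Subset k
∁ χ x = not (χ x)

Disjoint : ∀ {k} → Subset k → Subset k → Set
Disjoint A C = ∀ x → A x ≡ true → C x ≡ false

∣∣-cong : ∀ {k} {A C : Subset k} → A ≗ C → ∣ A ∣ ≡ ∣ C ∣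
∣∣-cong {k} A≗C = ∑-cong k (cong toℕ ∘ A≗C)

∣∣≡0 : ∀ {k} {χ : Subset k} → (∀ x → χ x ≡ false) → ∣ χ ∣ ≡ 0
∣∣≡0 {k} χ≗∅ = trans (∣∣-cong χ≗∅) (∑-zero k)

∣∣≤2^ : ∀ {k} (χ : Subset k) → ∣ χ ∣ ≤ 2 ^ k
∣∣≤2^ {k} χ = subst (∣ χ ∣ ≤_) (∑-one k) (∑-mono-≤ k (toℕ≤1 ∘ χ))

∣⁅⁆∩∣ : ∀ {k} (c : Vec Bool k) (p : Subset k) → ∣ ⁅ c ⁆ ∩ p ∣ ≡ toℕ (p c)
∣⁅⁆∩∣ []          p = refl
∣⁅⁆∩∣ {suc k} (false ∷ c) p =
  trans (cong₂ _+_ (∣⁅⁆∩∣ c (p ∘ (false ∷_))) (∑-zero k)) (+-identityʳ _)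
∣⁅⁆∩∣ {suc k} (true ∷ c)  p =
  trans (cong (_+ ∣ ⁅ c ⁆ ∩ p ∘ (true ∷_) ∣) (∑-zero k)) (∣⁅⁆∩∣ c (p ∘ (true ∷_)))

∣⁅⁆∣ : ∀ {k} (c : Vec Bool k) → ∣ ⁅ c ⁆ ∣ ≡ 1
∣⁅⁆∣ c = trans (∣∣-cong (λ x → sym (∧-identityʳ (c == x)))) (∣⁅⁆∩∣ c full)

∣∪∣ : ∀ {k} (A C : Subset k) → Disjoint A C → ∣ A ∪ C ∣ ≡ ∣ A ∣ + ∣ C ∣
∣∪∣ {k} A C A∩C≡∅ = trans (∑-cong k toℕ-∨) (∑-distrib-+ k (toℕ ∘ A) (toℕ ∘ C))
  where
  toℕ-∨ : ∀ x → toℕ (A x ∨ C x) ≡ toℕ (A x) + toℕ (C x)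
  toℕ-∨ x with A x in e
  ... | false = refl
  ... | true  rewrite A∩C≡∅ x e = refl

∣∁∣+∣∣ : ∀ {k} (χ : Subset k) → ∣ ∁ χ ∣ + ∣ χ ∣ ≡ 2 ^ k
∣∁∣+∣∣ {k} χ = trans (sym (∑-distrib-+ k _ _)) (trans (∑-cong k (toℕ-not+toℕ ∘ χ)) (∑-one k))
  where
  toℕ-not+toℕ : ∀ b → toℕ (not b) + toℕ b ≡ 1
  toℕ-not+toℕ false = refl
  toℕ-not+toℕ true  = refl

nonempty : ∀ {k} (χ : Subset k) → ∣ χ ∣ ≢ 0 → ∃ λ x → χ x ≡ true
nonempty {zero}  χ ∣χ∣≢0 with χ [] in e
... | true  = [] , e
... | false = ⊥-elim (∣χ∣≢0 refl)
nonempty {suc k} χ ∣χ∣≢0 with ∣ χ ∘ (false ∷_) ∣ ≟ 0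
... | no  ∣χ₀∣≢0 = let x , x∈χ₀ = nonempty (χ ∘ (false ∷_)) ∣χ₀∣≢0 in false ∷ x , x∈χ₀
... | yes ∣χ₀∣≡0 =
  let x , x∈χ₁ = nonempty (χ ∘ (true ∷_)) (∣χ∣≢0 ∘ cong₂ _+_ ∣χ₀∣≡0) in true ∷ x , x∈χ₁

∣∣≤1 : ∀ {k} (χ : Subset k) → (∀ x y → χ x ≡ true → χ y ≡ true → x ≡ y) → ∣ χ ∣ ≤ 1
∣∣≤1 {zero}  χ _      = toℕ≤1 (χ [])
∣∣≤1 {suc k} χ unique with ∣ χ ∘ (false ∷_) ∣ ≟ 0
... | yes ∣χ₀∣≡0 = subst (λ a → a + ∣ χ ∘ (true ∷_) ∣ ≤ 1) (sym ∣χ₀∣≡0)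
                     (∣∣≤1 (χ ∘ (true ∷_)) (λ x y p q → ∷-injectiveʳ (unique _ _ p q)))
... | no  ∣χ₀∣≢0 = subst (λ c → ∣ χ ∘ (false ∷_) ∣ + c ≤ 1) (sym ∣χ₁∣≡0)
                     (subst (_≤ 1) (sym (+-identityʳ _))
                        (∣∣≤1 (χ ∘ (false ∷_)) (λ x y p q → ∷-injectiveʳ (unique _ _ p q))))
  where
  witness = nonempty (χ ∘ (false ∷_)) ∣χ₀∣≢0
  ∣χ₁∣≡0 : ∣ χ ∘ (true ∷_) ∣ ≡ 0
  ∣χ₁∣≡0 = ∣∣≡0 λ y → ¬-not λ y∈χ₁ →
    case unique (false ∷ proj₁ witness) (true ∷ y) (proj₂ witness) y∈χ₁ of λ ()

sumOf : ∀ {k} → Subset k → Vec Bool k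
sumOf {zero}  χ = []
sumOf {suc k} χ = odd ∣ χ ∘ (true ∷_) ∣ ∷ (sumOf (χ ∘ (false ∷_)) ⊕ sumOf (χ ∘ (true ∷_)))

sumOf-cong : ∀ {k} {A C : Subset k} → A ≗ C → sumOf A ≡ sumOf C
sumOf-cong {zero}  A≗C = refl
sumOf-cong {suc k} A≗C = cong₂ _∷_ (cong odd (∣∣-cong (A≗C ∘ (true ∷_))))
                                   (cong₂ _⊕_ (sumOf-cong (A≗C ∘ (false ∷_))) (sumOf-cong (A≗C ∘ (true ∷_))))

∣∣≡0⇒sumOf≡0ᵛ : ∀ {k} (χ : Subset k) → ∣ χ ∣ ≡ 0 → sumOf χ ≡ 0ᵛ
∣∣≡0⇒sumOf≡0ᵛ {zero}  χ _     = refl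
∣∣≡0⇒sumOf≡0ᵛ {suc k} χ ∣χ∣≡0 = cong₂ _∷_ (cong odd ∣χ₁∣≡0)
  (trans (cong₂ _⊕_ (∣∣≡0⇒sumOf≡0ᵛ _ (m+n≡0⇒m≡0 _ ∣χ∣≡0)) (∣∣≡0⇒sumOf≡0ᵛ _ ∣χ₁∣≡0))
         (⊕-self 0ᵛ))
  where ∣χ₁∣≡0 = m+n≡0⇒n≡0 ∣ χ ∘ (false ∷_) ∣ ∣χ∣≡0

sumOf-⁅⁆ : ∀ {k} (c : Vec Bool k) → sumOf ⁅ c ⁆ ≡ c
sumOf-⁅⁆ []          = refl
sumOf-⁅⁆ {suc k} (false ∷ c) =
  cong₂ _∷_ (cong odd (∑-zero k))
            (trans (cong₂ _⊕_ (sumOf-⁅⁆ c) (∣∣≡0⇒sumOf≡0ᵛ ∅ (∑-zero k))) (⊕-identityʳ c))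
sumOf-⁅⁆ {suc k} (true ∷ c)  =
  cong₂ _∷_ (cong odd (∣⁅⁆∣ c))
            (trans (cong₂ _⊕_ (∣∣≡0⇒sumOf≡0ᵛ ∅ (∑-zero k)) (sumOf-⁅⁆ c)) (⊕-identityˡ c))

sumOf-∪ : ∀ {k} (A C : Subset k) → Disjoint A C → sumOf (A ∪ C) ≡ sumOf A ⊕ sumOf C
sumOf-∪ {zero}  A C _      = refl
sumOf-∪ {suc k} A C A∩C≡∅ = cong₂ _∷_
  (trans (cong odd (∣∪∣ A₁ C₁ (A∩C≡∅ ∘ (true ∷_)))) (odd-+ ∣ A₁ ∣ ∣ C₁ ∣))
  (trans (cong₂ _⊕_ (sumOf-∪ A₀ C₀ (A∩C≡∅ ∘ (false ∷_))) (sumOf-∪ A₁ C₁ (A∩C≡∅ ∘ (true ∷_))))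
         (⊕-interchange (sumOf A₀) (sumOf C₀) (sumOf A₁) (sumOf C₁)))
  where
  A₀ = A ∘ (false ∷_)
  A₁ = A ∘ (true ∷_)
  C₀ = C ∘ (false ∷_)
  C₁ = C ∘ (true ∷_)

sumOf-full : ∀ k → sumOf {suc (suc k)} full ≡ 0ᵛ
sumOf-full k = cong₂ _∷_ (trans (cong odd (∑-one (suc k))) (odd-2^suc k)) (⊕-self (sumOf full))

sumOf-∁ : ∀ {k} (χ : Subset (suc (suc k))) → sumOf (∁ χ) ≡ sumOf χ
sumOf-∁ {k} χ = ⊕≡0ᵛ⇒≡ (sumOf (∁ χ)) (sumOf χ) (begin
  sumOf (∁ χ) ⊕ sumOf χ  ≡⟨ sumOf-∪ (∁ χ) χ (λ x ¬χx → trans (sym (not-involutive (χ x))) (cong not ¬χx)) ⟨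
  sumOf (∁ χ ∪ χ)        ≡⟨ sumOf-cong (∨-inverseˡ ∘ χ) ⟩
  sumOf full             ≡⟨ sumOf-full k ⟩
  0ᵛ                     ∎)
  where open ≡-Reasoning

∣∩∁∣+∣∩∣ : ∀ {k} (χ p : Subset k) → ∣ χ ∩ ∁ p ∣ + ∣ χ ∩ p ∣ ≡ ∣ χ ∣
∣∩∁∣+∣∩∣ {k} χ p = trans (sym (∑-distrib-+ k _ _)) (∑-cong k (λ x → split (χ x) (p x)))
  where
  split : ∀ a b → toℕ (a ∧ not b) + toℕ (a ∧ b) ≡ toℕ a
  split false _     = refl
  split true  false = refl
  split true  true  = refl

·-sumOf : ∀ {k} (m : Vec Bool k) (χ : Subset k) → m · sumOf χ ≡ odd ∣ χ ∩ (m ·_) ∣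
·-sumOf []      χ = cong (odd ∘ toℕ) (sym (∧-zeroʳ (χ [])))
·-sumOf (b ∷ m) χ = begin
  (b ∧ odd ∣ χ₁ ∣) xor m · (sumOf χ₀ ⊕ sumOf χ₁)
    ≡⟨ cong ((b ∧ odd ∣ χ₁ ∣) xor_) (·-distribʳ-⊕ m (sumOf χ₀) (sumOf χ₁)) ⟩
  (b ∧ odd ∣ χ₁ ∣) xor (m · sumOf χ₀ xor m · sumOf χ₁)
    ≡⟨ cong ((b ∧ odd ∣ χ₁ ∣) xor_) (cong₂ _xor_ (·-sumOf m χ₀) (·-sumOf m χ₁)) ⟩
  (b ∧ odd ∣ χ₁ ∣) xor (odd ∣ χ₀ ∩ (m ·_) ∣ xor odd ∣ χ₁ ∩ (m ·_) ∣)  ≡⟨ byHead b ⟩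
  odd ∣ χ ∩ ((b ∷ m) ·_) ∣  ∎
  where
  open ≡-Reasoning
  χ₀ = χ ∘ (false ∷_)
  χ₁ = χ ∘ (true ∷_)
  byHead : ∀ b → (b ∧ odd ∣ χ₁ ∣) xor (odd ∣ χ₀ ∩ (m ·_) ∣ xor odd ∣ χ₁ ∩ (m ·_) ∣)
                 ≡ odd ∣ χ ∩ ((b ∷ m) ·_) ∣
  byHead false = sym (odd-+ ∣ χ₀ ∩ (m ·_) ∣ ∣ χ₁ ∩ (m ·_) ∣)
  byHead true  = begin
    odd ∣ χ₁ ∣ xor (x xor y)                                ≡⟨ cong (_xor (x xor y)) (cong odd (∣∩∁∣+∣∩∣ χ₁ (m ·_))) ⟨
    odd (∣ χ₁ ∩ ∁ (m ·_) ∣ + ∣ χ₁ ∩ (m ·_) ∣) xor (x xor y) ≡⟨ cong (_xor (x xor y)) (odd-+ ∣ χ₁ ∩ ∁ (m ·_) ∣ _) ⟩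
    (z xor y) xor (x xor y)                                 ≡⟨ xor-interchange z y x y ⟩
    (z xor x) xor (y xor y)                                 ≡⟨ cong ((z xor x) xor_) (xor-same y) ⟩
    (z xor x) xor false                                     ≡⟨ xor-identityʳ (z xor x) ⟩
    z xor x                                                 ≡⟨ xor-comm z x ⟩
    x xor z                                                 ≡⟨ odd-+ ∣ χ₀ ∩ (m ·_) ∣ ∣ χ₁ ∩ ∁ (m ·_) ∣ ⟨
    odd ∣ χ ∩ ((true ∷ m) ·_) ∣                             ∎
    where
    x = odd ∣ χ₀ ∩ (m ·_) ∣
    y = odd ∣ χ₁ ∩ (m ·_) ∣
    z = odd ∣ χ₁ ∩ ∁ (m ·_) ∣

∣∣≡1⇒sumOf≢0ᵛ : ∀ {k} (χ : Subset k) → χ 0ᵛ ≡ false → ∣ χ ∣ ≡ 1 → sumOf χ ≢ 0ᵛ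
∣∣≡1⇒sumOf≢0ᵛ {zero}  χ 0∉χ ∣χ∣≡1 _ = 0≢1+n (trans (cong toℕ (sym 0∉χ)) ∣χ∣≡1)
∣∣≡1⇒sumOf≢0ᵛ {suc k} χ 0∉χ ∣χ∣≡1 Σχ≡0 =
  ∣∣≡1⇒sumOf≢0ᵛ χ₀ 0∉χ ∣χ₀∣≡1 (trans (⊕≡0ᵛ⇒≡ (sumOf χ₀) (sumOf χ₁) (cong tail Σχ≡0)) Σχ₁≡0)
  where
  χ₀ = χ ∘ (false ∷_)
  χ₁ = χ ∘ (true ∷_)
  ∣χ₁∣≡0 : ∣ χ₁ ∣ ≡ 0
  ∣χ₁∣≡0 = even≤1 ∣ χ₁ ∣ (subst (∣ χ₁ ∣ ≤_) ∣χ∣≡1 (m≤n+m ∣ χ₁ ∣ ∣ χ₀ ∣)) (cong head Σχ≡0)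
    where
    even≤1 : ∀ n → n ≤ 1 → odd n ≡ false → n ≡ 0
    even≤1 zero    _         _  = refl
    even≤1 (suc zero) _      ()
    even≤1 (suc (suc n)) (s≤s ()) _
  ∣χ₀∣≡1 : ∣ χ₀ ∣ ≡ 1
  ∣χ₀∣≡1 = trans (sym (+-identityʳ ∣ χ₀ ∣)) (subst (λ c → ∣ χ₀ ∣ + c ≡ 1) ∣χ₁∣≡0 ∣χ∣≡1)
  Σχ₁≡0 : sumOf χ₁ ≡ 0ᵛ
  Σχ₁≡0 = ∣∣≡0⇒sumOf≡0ᵛ χ₁ ∣χ₁∣≡0

∣∣≡2⇒sumOf≢0ᵛ : ∀ {k} (χ : Subset k) → ∣ χ ∣ ≡ 2 → sumOf χ ≢ 0ᵛ
∣∣≡2⇒sumOf≢0ᵛ {zero}  χ ∣χ∣≡2 _ = <⇒≢ (s≤s (toℕ≤1 (χ []))) ∣χ∣≡2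
∣∣≡2⇒sumOf≢0ᵛ {suc k} χ ∣χ∣≡2 Σχ≡0
  with even-split-2 ∣ χ ∘ (false ∷_) ∣ ∣ χ ∘ (true ∷_) ∣ ∣χ∣≡2 (cong head Σχ≡0)
... | inj₁ (∣χ₀∣≡2 , ∣χ₁∣≡0) = ∣∣≡2⇒sumOf≢0ᵛ (χ ∘ (false ∷_)) ∣χ₀∣≡2
  (trans (⊕≡0ᵛ⇒≡ _ _ (cong tail Σχ≡0)) (∣∣≡0⇒sumOf≡0ᵛ (χ ∘ (true ∷_)) ∣χ₁∣≡0))
... | inj₂ (∣χ₀∣≡0 , ∣χ₁∣≡2) = ∣∣≡2⇒sumOf≢0ᵛ (χ ∘ (true ∷_)) ∣χ₁∣≡2
  (trans (sym (⊕≡0ᵛ⇒≡ _ _ (cong tail Σχ≡0))) (∣∣≡0⇒sumOf≡0ᵛ (χ ∘ (false ∷_)) ∣χ₀∣≡0))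

record SumSet (k q : ℕ) (s : Vec Bool k) : Set where
  field
    points : Subset k
    size   : ∣ points ∣ ≡ q
    sum    : sumOf points ≡ s

open SumSet

castˢ : ∀ {k q q′ s s′} → q ≡ q′ → s ≡ s′ → SumSet k q s → SumSet k q′ s′
castˢ q≡q′ s≡s′ S = record { points = points S ; size = trans (size S) q≡q′ ; sum = trans (sum S) s≡s′ }

∅ˢ : ∀ {k} → SumSet k 0 0ᵛ
∅ˢ {k} = record { points = ∅ ; size = ∑-zero k ; sum = ∣∣≡0⇒sumOf≡0ᵛ ∅ (∑-zero k) }

⁅_⁆ˢ : ∀ {k} (c : Vec Bool k) → SumSet k 1 c
⁅ c ⁆ˢ = record { points = ⁅ c ⁆ ; size = ∣⁅⁆∣ c ; sum = sumOf-⁅⁆ c }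

join : ∀ {k} → Subset k → Subset k → Subset (suc k)
join A C (false ∷ x) = A x
join A C (true ∷ x)  = C x

joinˢ : ∀ {k a b s t} → SumSet k a s → SumSet k b t → SumSet (suc k) (a + b) (odd b ∷ (s ⊕ t))
joinˢ A C = record
  { points = join (points A) (points C)
  ; size   = cong₂ _+_ (size A) (size C)
  ; sum    = cong₂ _∷_ (cong odd (size C)) (cong₂ _⊕_ (sum A) (sum C))
  }

∪ˢ : ∀ {k a b s t} (A : SumSet k a s) (C : SumSet k b t) → Disjoint (points A) (points C) →
     SumSet k (a + b) (s ⊕ t)
∪ˢ A C A∩C≡∅ = record
  { points = points A ∪ points C
  ; size   = trans (∣∪∣ (points A) (points C) A∩C≡∅) (cong₂ _+_ (size A) (size C))
  ; sum    = trans (sumOf-∪ (points A) (points C) A∩C≡∅) (cong₂ _⊕_ (sum A) (sum C))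
  }

∁ˢ : ∀ {k q q′ s} (A : SumSet (suc (suc k)) q s) → q + q′ ≡ 2 ^ suc (suc k) → SumSet (suc (suc k)) q′ s
∁ˢ {k} {q} {q′} A q+q′≡2^k = record
  { points = ∁ (points A)
  ; size   = +-cancelʳ-≡ q _ _ (begin
      ∣ ∁ (points A) ∣ + q                 ≡⟨ cong (∣ ∁ (points A) ∣ +_) (size A) ⟨
      ∣ ∁ (points A) ∣ + ∣ points A ∣      ≡⟨ ∣∁∣+∣∣ (points A) ⟩
      2 ^ suc (suc k)                      ≡⟨ q+q′≡2^k ⟨
      q + q′                               ≡⟨ +-comm q q′ ⟩
      q′ + q                               ∎)
  ; sum    = trans (sumOf-∁ (points A)) (sum A)
  }
  where open ≡-Reasoning

mutual
  onesSumSet : ∀ k q → 1 ≤ q → q < 2 ^ k → SumSet k q 1ᵛ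
  onesSumSet zero    q 1≤q q<1 = ⊥-elim (<⇒≱ q<1 1≤q)
  onesSumSet (suc k) q 1≤q q<2M with q ≤? 2 ^ k
  ... | yes q≤M = onesSumSet-≤half k q 1≤q q≤M
  ... | no  q≰M = onesSumSet->half k q (≰⇒> q≰M) q<2M

  onesSumSet-≤half : ∀ k q → 1 ≤ q → q ≤ 2 ^ k → SumSet (suc k) q 1ᵛ
  onesSumSet-≤half k 1 _ _ = ⁅ 1ᵛ ⁆ˢ
  onesSumSet-≤half k (suc (suc q)) _ q+2≤M =
    castˢ (+-comm (suc q) 1) (cong (true ∷_) (⊕-identityʳ 1ᵛ))
      (joinˢ (onesSumSet k (suc q) (s≤s z≤n) q+2≤M) ⁅ 0ᵛ ⁆ˢ)

  onesSumSet->half : ∀ k q → 2 ^ k < q → q < 2 ^ suc k → SumSet (suc k) q 1ᵛ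
  onesSumSet->half zero    q 1<q q<2 = ⊥-elim (<⇒≱ q<2 1<q)
  onesSumSet->half (suc k) q M<q q<2M =
    let q′ , q′<M , q′+q≡2M = mirror M<q (subst (q ≤_) (2^suc (suc k)) (<⇒≤ q<2M))
        q′+q≡2^k = trans q′+q≡2M (sym (2^suc (suc k)))
        q′≢0 = λ (q′≡0 : q′ ≡ 0) → <⇒≢ q<2M (trans (cong (_+ q) (sym q′≡0)) q′+q≡2^k)
    in ∁ˢ (onesSumSet-≤half (suc k) q′ (n≢0⇒n>0 q′≢0) (<⇒≤ q′<M)) q′+q≡2^k

zeroSumSet-≤half : ∀ k q → q ≤ 2 ^ k → q ≢ 2 → SumSet (suc k) q 0ᵛ
zeroSumSet-≤half k 0 _ _ = ∅ˢ
zeroSumSet-≤half k 1 _ _ = ⁅ 0ᵛ ⁆ˢ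
zeroSumSet-≤half k 2 _ q≢2 = ⊥-elim (q≢2 refl)
zeroSumSet-≤half k (suc (suc (suc q))) q+3≤M _ =
  castˢ (+-comm (suc q) 2) (cong (false ∷_) (⊕-self 1ᵛ))
    (joinˢ (onesSumSet k (suc q) (s≤s z≤n) (≤-trans (n≤1+n _) q+3≤M))
           (onesSumSet k 2 (s≤s z≤n) (≤-trans (s≤s (s≤s (s≤s z≤n))) q+3≤M)))

zeroSumSet->half : ∀ k q → 2 ^ k < q → q ≤ 2 ^ suc k → q ≢ 2 → 2 + q ≢ 2 ^ suc k → SumSet (suc k) q 0ᵛ
zeroSumSet->half zero    q 1<q q≤2 q≢2 _ = ⊥-elim (q≢2 (≤-antisym q≤2 1<q))
zeroSumSet->half (suc k) q M<q q≤2M _ q+2≢2M =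
  let q′ , q′<M , q′+q≡2M = mirror M<q (subst (q ≤_) (2^suc (suc k)) q≤2M)
      q′+q≡2^k = trans q′+q≡2M (sym (2^suc (suc k)))
      q′≢2 = λ (q′≡2 : q′ ≡ 2) → q+2≢2M (trans (cong (_+ q) (sym q′≡2)) q′+q≡2^k)
  in ∁ˢ (zeroSumSet-≤half (suc k) q′ (<⇒≤ q′<M) q′≢2) q′+q≡2^k

zeroSumSet : ∀ k q → q ≤ 2 ^ suc k → q ≢ 2 → 2 + q ≢ 2 ^ suc k → SumSet (suc k) q 0ᵛ
zeroSumSet k q q≤2M q≢2 q+2≢2M with q ≤? 2 ^ k
... | yes q≤M = zeroSumSet-≤half k q q≤M q≢2
... | no  q≰M = zeroSumSet->half k q (≰⇒> q≰M) q≤2M q≢2 q+2≢2M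

-- Stated dually: χ spans F₂ᵏ iff no nonzero linear form vanishes on it.
Spanning : ∀ {k} → Subset k → Set
Spanning {k} χ = ∀ m → (∀ x → χ x ≡ true → m · x ≡ false) → m ≡ 0ᵛ

spanning-join : ∀ {k} {A C : Subset k} → Spanning A → (∃ λ y → C y ≡ true) → Spanning (join A C)
spanning-join {A = A} {C} A-spans (y , y∈C) (b ∷ m) m⊥ = cong₂ _∷_ b≡false m≡0
  where
  m≡0 : m ≡ 0ᵛ
  m≡0 = A-spans m (λ x x∈A → trans (cong (_xor m · x) (sym (∧-zeroʳ b))) (m⊥ (false ∷ x) x∈A))
  b≡false : b ≡ false
  b≡false = begin
    b                       ≡⟨ ∧-identityʳ b ⟨
    b ∧ true                ≡⟨ xor-identityʳ (b ∧ true) ⟨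
    (b ∧ true) xor false    ≡⟨ cong ((b ∧ true) xor_) (·-zeroˡ y) ⟨
    (b ∧ true) xor 0ᵛ · y   ≡⟨ cong (λ v → (b ∧ true) xor v · y) m≡0 ⟨
    (b ∧ true) xor m · y    ≡⟨ m⊥ (true ∷ y) y∈C ⟩
    false                   ∎
    where open ≡-Reasoning

spanning-⊇nonzero∖1ᵛ : ∀ {k} (χ : Subset (suc (suc k))) →
                       (∀ x → x ≢ 0ᵛ → x ≢ 1ᵛ → χ x ≡ true) → Spanning χ
spanning-⊇nonzero∖1ᵛ {k} χ ⊇ m m⊥ = ·≡false⇒≡0ᵛ m (λ x → trans (·-comm x m) (m⊥′ x))
  where
  _≟ᵛ_ = ≡-dec _≟ᵇ_
  e₁ e₁′ : Vec Bool (suc (suc k))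
  e₁  = true ∷ 0ᵛ
  e₁′ = false ∷ 1ᵛ
  m⊥′ : ∀ x → m · x ≡ false
  m⊥′ x with x ≟ᵛ 0ᵛ | x ≟ᵛ 1ᵛ
  ... | yes refl | _        = ·-zeroʳ m
  ... | no  x≢0  | no  x≢1  = m⊥ x (⊇ x x≢0 x≢1)
  ... | no  _    | yes refl = begin
    m · 1ᵛ                ≡⟨ cong (λ v → m · (true ∷ v)) (⊕-identityˡ 1ᵛ) ⟨
    m · (e₁ ⊕ e₁′)        ≡⟨ ·-distribʳ-⊕ m e₁ e₁′ ⟩
    m · e₁ xor m · e₁′    ≡⟨ cong₂ _xor_ (m⊥ e₁ (⊇ e₁ (λ ()) (λ ())))
                                       (m⊥ e₁′ (⊇ e₁′ (λ ()) (λ ()))) ⟩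
    false                 ∎
    where open ≡-Reasoning

record SpanningSet (k p : ℕ) (s : Vec Bool k) : Set where
  field
    base     : SumSet k p s
    0∉       : points base 0ᵛ ≡ false
    spanning : Spanning (points base)

open SpanningSet

castˢᵖ : ∀ {k p p′ s s′} → p ≡ p′ → s ≡ s′ → SpanningSet k p s → SpanningSet k p′ s′
castˢᵖ p≡p′ s≡s′ P = record { base = castˢ p≡p′ s≡s′ (base P) ; 0∉ = 0∉ P ; spanning = spanning P }

joinˢᵖ : ∀ {k p q s t} → SpanningSet k p s → (C : SumSet k q t) → 1 ≤ q →
         SpanningSet (suc k) (p + q) (odd q ∷ (s ⊕ t))
joinˢᵖ P C 1≤q = record
  { base     = joinˢ (base P) C
  ; 0∉       = 0∉ P
  ; spanning = spanning-join (spanning P) (nonempty (points C) (m<n⇒n≢0 1≤q ∘ trans (sym (size C))))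
  }

joinˢᵖ-even : ∀ {k p q s} → SpanningSet k p s → (C : SumSet k q s) → 1 ≤ q → odd q ≡ false →
              SpanningSet (suc k) (p + q) 0ᵛ
joinˢᵖ-even {s = s} P C 1≤q q-even =
  castˢᵖ refl (cong₂ _∷_ q-even (⊕-self s)) (joinˢᵖ P C 1≤q)

units : ∀ k → SpanningSet k k 1ᵛ
units zero    = record { base = ∅ˢ ; 0∉ = refl ; spanning = λ { [] _ → refl } }
units (suc k) = castˢᵖ (+-comm k 1) (cong (true ∷_) (⊕-identityʳ 1ᵛ))
                  (joinˢᵖ (units k) ⁅ 0ᵛ ⁆ˢ (s≤s z≤n))

zeroOne : ∀ {k} → SumSet (suc k) 2 1ᵛ
zeroOne {k} = castˢ refl (⊕-identityˡ 1ᵛ) (∪ˢ ⁅ 0ᵛ ⁆ˢ ⁅ 1ᵛ ⁆ˢ 1ᵛ∉⁅0ᵛ⁆)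
  where
  1ᵛ∉⁅0ᵛ⁆ : ∀ (x : Vec Bool (suc k)) → (0ᵛ == x) ≡ true → (1ᵛ == x) ≡ false
  1ᵛ∉⁅0ᵛ⁆ x 0ᵛ≡x = cong (1ᵛ ==_) (sym (==⇒≡ {x = 0ᵛ} {x} 0ᵛ≡x))

unitsAndOnes : ∀ k → SpanningSet (suc (suc k)) (3 + k) 0ᵛ
unitsAndOnes k = castˢᵖ (+-comm (suc k) 2) refl
                   (joinˢᵖ-even (units (suc k)) zeroOne (s≤s z≤n) refl)

nonzero : ∀ {k} p → 1 + p ≡ 2 ^ suc (suc k) → SpanningSet (suc (suc k)) p 0ᵛ
nonzero {k} p 1+p≡2^k = record
  { base     = ∁ˢ ⁅ 0ᵛ ⁆ˢ 1+p≡2^k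
  ; 0∉       = cong not (==-refl (0ᵛ {suc (suc k)}))
  ; spanning = spanning-⊇nonzero∖1ᵛ _ (λ x x≢0 _ → cong not (≢⇒==false (x≢0 ∘ sym)))
  }

nonzero∖1ᵛ : ∀ {k} p → 2 + p ≡ 2 ^ suc (suc k) → SpanningSet (suc (suc k)) p 1ᵛ
nonzero∖1ᵛ {k} p 2+p≡2^k = record
  { base     = ∁ˢ zeroOne 2+p≡2^k
  ; 0∉       = cong (λ b → not (b ∨ false)) (==-refl (0ᵛ {suc (suc k)}))
  ; spanning = spanning-⊇nonzero∖1ᵛ _ (λ x x≢0 x≢1 →
                 cong₂ (λ a b → not (a ∨ b)) (≢⇒==false (x≢0 ∘ sym)) (≢⇒==false (x≢1 ∘ sym)))
  }

-- The one size for which {0} × P ∪ {1} × Q would need a two-point Q with zero sum; instead both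
-- parts are given the sum (1, 0, …, 0).
spanningSet-K+2 : ∀ j → SpanningSet (4 + j) ((3 + j) + 3) 0ᵛ
spanningSet-K+2 j = castˢᵖ (+-assoc (3 + j) 1 2) refl (joinˢᵖ-even P Q (s≤s z≤n) refl)
  where
  P : SpanningSet (3 + j) ((3 + j) + 1) (true ∷ 0ᵛ)
  P = castˢᵖ refl (cong (true ∷_) (⊕-self 0ᵛ)) (joinˢᵖ (unitsAndOnes j) ⁅ 0ᵛ ⁆ˢ (s≤s z≤n))
  Q : SumSet (3 + j) 2 (true ∷ 0ᵛ)
  Q = castˢ refl (cong (true ∷_) (⊕-self 0ᵛ)) (joinˢ ⁅ 0ᵛ ⁆ˢ ⁅ 0ᵛ ⁆ˢ)

spanningSet-low : ∀ j n → 5 + j ≤ n → n ≤ 2 ^ (3 + j) + 1 → SpanningSet (4 + j) n 0ᵛ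
spanningSet-low j n 5+j≤n n≤M+1 with q , refl ← ≤⇒+ 5+j≤n =
  castˢᵖ (rearrange j q) refl (bySize q q+4≤M)
  where
  rearrange : ∀ j q → (3 + j) + (2 + q) ≡ (5 + j) + q
  rearrange = solve-∀
  q+4≤M : 4 + q ≤ 2 ^ (3 + j)
  q+4≤M = ≤-trans (+-monoʳ-≤ 4 (m≤n+m q j)) (≤-pred (subst (5 + j + q ≤_) (+-comm (2 ^ (3 + j)) 1) n≤M+1))
  bySize : ∀ q → 4 + q ≤ 2 ^ (3 + j) → SpanningSet (4 + j) ((3 + j) + (2 + q)) 0ᵛ
  bySize q q+4≤M with odd q in q-parity
  ... | false = joinˢᵖ-even (units (3 + j)) (onesSumSet (3 + j) (2 + q) (s≤s z≤n) (≤-trans (n≤1+n _) q+4≤M))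
                  (s≤s z≤n) (trans (odd-2+ q) q-parity)
  bySize 1 _ | true = spanningSet-K+2 j
  bySize (suc (suc q)) q+6≤M | true =
    castˢᵖ (size-eq j q) refl
      (joinˢᵖ-even (unitsAndOnes (suc j))
         (zeroSumSet (2 + j) (3 + q) (≤-trans (m≤n+m (3 + q) 3) q+6≤M) (λ ()) (<⇒≢ q+6≤M))
         (s≤s z≤n) (cong not q-parity))
    where
    size-eq : ∀ j q → (4 + j) + (3 + q) ≡ (3 + j) + (2 + (2 + q))
    size-eq = solve-∀

spanningSet-high : ∀ j n → 2 ^ (3 + j) + 2 ≤ n → n < 2 ^ (4 + j) → 2 + n ≢ 2 ^ (4 + j) → 3 + n ≢ 2 ^ (4 + j) →
                   SpanningSet (4 + j) n 0ᵛ
spanningSet-high j n M+2≤n n<2M n+2≢2M n+3≢2M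
  with r , refl ← ≤⇒+ M+2≤n | p , 2+p≡M ← ≤⇒+ (*-monoʳ-≤ 2 (m^n>0 2 (2 + j))) =
  castˢᵖ size-eq refl (bySize r 3+r≤M 4+r≢M 5+r≢M)
  where
  M = 2 ^ (3 + j)
  shift : ∀ c M r → c + (M + 2 + r) ≡ M + (c + 2 + r)
  shift = solve-∀
  3+r≤M : 3 + r ≤ M
  3+r≤M = +-cancelˡ-≤ M _ _ (subst (_≤ M + M) (shift 1 M r) (subst (M + 2 + r <_) (2^suc (3 + j)) n<2M))
  4+r≢M : 4 + r ≢ M
  4+r≢M 4+r≡M = n+2≢2M (trans (shift 2 M r) (trans (cong (M +_) 4+r≡M) (sym (2^suc (3 + j)))))
  5+r≢M : 5 + r ≢ M
  5+r≢M 5+r≡M = n+3≢2M (trans (shift 3 M r) (trans (cong (M +_) 5+r≡M) (sym (2^suc (3 + j)))))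
  size-eq : p + (4 + r) ≡ M + 2 + r
  size-eq = trans (rearrange p r) (cong (λ m → m + 2 + r) 2+p≡M)
    where
    rearrange : ∀ p r → p + (4 + r) ≡ 2 + p + 2 + r
    rearrange = solve-∀
  bySize : ∀ r → 3 + r ≤ M → 4 + r ≢ M → 5 + r ≢ M → SpanningSet (4 + j) (p + (4 + r)) 0ᵛ
  bySize r r+3≤M r+4≢M r+5≢M with odd r in r-parity
  ... | false = joinˢᵖ-even (nonzero∖1ᵛ p 2+p≡M) (onesSumSet (3 + j) (4 + r) (s≤s z≤n) r+5≤M)
                  (s≤s z≤n) (trans (odd-2+ (2 + r)) (trans (odd-2+ r) r-parity))
    where
    r+3≢M : 3 + r ≢ M
    r+3≢M r+3≡M = case trans (sym odd[3+r]) (trans (cong odd r+3≡M) (odd-2^suc (2 + j))) of λ ()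
      where odd[3+r] = cong not (trans (odd-2+ r) r-parity)
    r+5≤M : 5 + r ≤ M
    r+5≤M = ≤∧≢⇒< (≤∧≢⇒< r+3≤M r+3≢M) r+4≢M
  ... | true  = castˢᵖ (sym (+-suc p (3 + r))) refl
                  (joinˢᵖ-even (nonzero (1 + p) 2+p≡M) (zeroSumSet (2 + j) (3 + r) r+3≤M (λ ()) r+5≢M)
                     (s≤s z≤n) (cong not (trans (odd-2+ r) r-parity)))

spanningSet-exists : ∀ K n → K + 1 ≤ n → n < 2 ^ K → 2 + n ≢ 2 ^ K → 3 + n ≢ 2 ^ K → SpanningSet K n 0ᵛ
spanningSet-exists 0 n K+1≤n n<2^K _ _ = ⊥-elim (<⇒≱ n<2^K K+1≤n)
spanningSet-exists 1 n K+1≤n n<2^K _ _ = ⊥-elim (<⇒≱ n<2^K K+1≤n)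
spanningSet-exists 2 n K+1≤n n<4 _ _ with ≤⇒+ K+1≤n
... | 0     , refl = nonzero 3 refl
... | suc d , refl = ⊥-elim (<⇒≱ n<4 (m≤m+n 4 d))
spanningSet-exists 3 n K+1≤n n<8 n+2≢8 n+3≢8 with ≤⇒+ K+1≤n
... | 0 , refl = joinˢᵖ-even (units 2) (onesSumSet 2 2 (s≤s z≤n) (s≤s (s≤s (s≤s z≤n)))) (s≤s z≤n) refl
... | 1 , refl = ⊥-elim (n+3≢8 refl)
... | 2 , refl = ⊥-elim (n+2≢8 refl)
... | 3 , refl = joinˢᵖ-even (nonzero 3 refl) (zeroSumSet 1 4 ≤-refl (λ ()) (λ ())) (s≤s z≤n) refl
... | suc (suc (suc (suc d))) , refl = ⊥-elim (<⇒≱ n<8 (m≤m+n 8 d))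
spanningSet-exists (suc (suc (suc (suc j)))) n K+1≤n n<2M n+2≢2M n+3≢2M with n ≤? 2 ^ (3 + j) + 1
... | yes n≤M+1 = spanningSet-low j n (subst (_≤ n) (+-comm (4 + j) 1) K+1≤n) n≤M+1
... | no  n≰M+1 = spanningSet-high j n (subst (_≤ n) (sym (+-suc (2 ^ (3 + j)) 1)) (≰⇒> n≰M+1)) n<2M n+2≢2M n+3≢2M

elements : ∀ {k} (χ : Subset k) → Vec (Vec Bool k) ∣ χ ∣
elements {zero}  χ with χ []
... | true  = [] ∷ []
... | false = []
elements {suc k} χ = map (false ∷_) (elements (χ ∘ (false ∷_))) ++ map (true ∷_) (elements (χ ∘ (true ∷_)))

elements-sound : ∀ {k} (χ : Subset k) → All (λ x → χ x ≡ true) (elements χ)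
elements-sound {zero}  χ with χ [] in χ[]
... | true  = χ[] ∷ []
... | false = []
elements-sound {suc k} χ =
  All.++⁺ (All.map⁺ (elements-sound (χ ∘ (false ∷_)))) (All.map⁺ (elements-sound (χ ∘ (true ∷_))))

elements-complete : ∀ {k} (χ : Subset k) {x} → χ x ≡ true → x ∈ elements χ
elements-complete {zero}  χ {[]}        χ[] rewrite χ[] = here refl
elements-complete {suc k} χ {false ∷ x} x∈χ = ∈-++⁺ˡ (∈-map⁺ (false ∷_) (elements-complete (χ ∘ (false ∷_)) x∈χ))
elements-complete {suc k} χ {true ∷ x}  x∈χ = ∈-++⁺ʳ _ (∈-map⁺ (true ∷_) (elements-complete (χ ∘ (true ∷_)) x∈χ))

elements-unique : ∀ {k} (χ : Subset k) → Unique (elements χ)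
elements-unique {zero}  χ with χ []
... | true  = [] ∷ []
... | false = []
elements-unique {suc k} χ =
  AllPairs.++⁺ (Unique.map⁺ ∷-injectiveʳ (elements-unique (χ ∘ (false ∷_))))
               (Unique.map⁺ ∷-injectiveʳ (elements-unique (χ ∘ (true ∷_))))
               (All.map⁺ (All.universal (λ _ → All.map⁺ (All.universal (λ _ ()) _)) _))

vec-ext : ∀ {A : Set} {n} {u v : Vec A n} → (∀ i → lookup u i ≡ lookup v i) → u ≡ v
vec-ext {u = u} {v} u≗v = trans (sym (tabulate∘lookup u)) (trans (tabulate-cong u≗v) (tabulate∘lookup v))

fromColumns : ∀ {n k} → Vec (Vec Bool k) n → GenMatrix n k
fromColumns cols = tabulate (λ i → map (λ c → lookup c i) cols)

column-fromColumns : ∀ {n k} (cols : Vec (Vec Bool k) n) j → column (fromColumns cols) j ≡ lookup cols j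
column-fromColumns cols j = vec-ext λ i → begin
  lookup (map (λ row → lookup row j) (fromColumns cols)) i  ≡⟨ lookup-map i _ (fromColumns cols) ⟩
  lookup (lookup (fromColumns cols) i) j                    ≡⟨ cong (λ row → lookup row j) (lookup∘tabulate _ i) ⟩
  lookup (map (λ c → lookup c i) cols) j                    ≡⟨ lookup-map j _ cols ⟩
  lookup (lookup cols j) i                                  ∎
  where open ≡-Reasoning

lookup-encode : ∀ {n k} (G : GenMatrix n k) m j → lookup (encode G m) j ≡ m · column G j
lookup-encode G m j = lookup∘tabulate _ j

anyᶠ : ∀ {n} → (Fin n → Bool) → Bool
anyᶠ {zero}  f = false
anyᶠ {suc n} f = f zero ∨ anyᶠ (f ∘ suc)

anyᶠ-intro : ∀ {n} (f : Fin n → Bool) j → f j ≡ true → anyᶠ f ≡ true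
anyᶠ-intro f zero    fj = cong (_∨ anyᶠ (f ∘ suc)) fj
anyᶠ-intro f (suc j) fj = trans (cong (f zero ∨_) (anyᶠ-intro (f ∘ suc) j fj)) (∨-zeroʳ (f zero))

anyᶠ-elim : ∀ {n} (f : Fin n → Bool) → anyᶠ f ≡ true → ∃ λ j → f j ≡ true
anyᶠ-elim {suc n} f any≡true with f zero in f₀
... | true  = zero , f₀
... | false = let j , fj = anyᶠ-elim (f ∘ suc) any≡true in suc j , fj

toℕ-anyᶠ : ∀ {n} (f : Fin n → Bool) → (∀ i j → f i ≡ true → f j ≡ true → i ≡ j) →
           toℕ (anyᶠ f) ≡ ∑ᶠ n (toℕ ∘ f)
toℕ-anyᶠ {zero}  f _      = refl
toℕ-anyᶠ {suc n} f unique with f zero in f₀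
... | false = toℕ-anyᶠ (f ∘ suc) (λ i j p q → Fin.suc-injective (unique _ _ p q))
... | true  = sym (cong suc (∑ᶠ-zero n (λ j → cong toℕ (¬-not (λ fj → case unique zero (suc j) f₀ fj of λ ())))))

anyᶠ-∧ʳ : ∀ {n} (f : Fin n → Bool) b → anyᶠ (λ j → f j ∧ b) ≡ anyᶠ f ∧ b
anyᶠ-∧ʳ {zero}  f b = refl
anyᶠ-∧ʳ {suc n} f b = trans (cong ((f zero ∧ b) ∨_) (anyᶠ-∧ʳ (f ∘ suc) b)) (sym (∧-distribʳ-∨ b (f zero) _))

columnSet : ∀ {n k} → GenMatrix n k → Subset k
columnSet G x = anyᶠ (λ j → column G j == x)

column∈columnSet : ∀ {n k} (G : GenMatrix n k) j → columnSet G (column G j) ≡ true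
column∈columnSet G j = anyᶠ-intro _ j (==-refl (column G j))

columnSet⇒column : ∀ {n k} (G : GenMatrix n k) {x} → columnSet G x ≡ true → ∃ λ j → column G j ≡ x
columnSet⇒column G x∈G = let j , cⱼ==x = anyᶠ-elim _ x∈G in j , ==⇒≡ cⱼ==x

column-injective : ∀ {n k} (G : GenMatrix n k) → Projective G → ∀ i j → column G i ≡ column G j → i ≡ j
column-injective G (_ , distinct) i j cᵢ≡cⱼ with i Fin.≟ j
... | yes i≡j = i≡j
... | no  i≢j = ⊥-elim (distinct i j i≢j cᵢ≡cⱼ)

fullRank⇔spanning : ∀ {n k} (G : GenMatrix n k) → FullRank G ⇔ Spanning (columnSet G)
fullRank⇔spanning {n} G = mk⇔ fullRank⇒spanning spanning⇒fullRank
  where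
  fullRank⇒spanning : FullRank G → Spanning (columnSet G)
  fullRank⇒spanning fullRank m m⊥ = fullRank m (vec-ext λ j → begin
    lookup (encode G m) j       ≡⟨ lookup-encode G m j ⟩
    m · column G j              ≡⟨ m⊥ _ (column∈columnSet G j) ⟩
    false                       ≡⟨ lookup-replicate j false ⟨
    lookup (replicate n false) j ∎)
    where open ≡-Reasoning
  spanning⇒fullRank : Spanning (columnSet G) → FullRank G
  spanning⇒fullRank spans m mG≡0 = spans m λ x x∈G → let j , cⱼ≡x = columnSet⇒column G x∈G in begin
    m · x                   ≡⟨ cong (m ·_) cⱼ≡x ⟨
    m · column G j          ≡⟨ lookup-encode G m j ⟨
    lookup (encode G m) j   ≡⟨ cong (λ v → lookup v j) mG≡0 ⟩
    lookup (replicate n false) j ≡⟨ lookup-replicate j false ⟩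
    false                   ∎
    where open ≡-Reasoning

module _ {n k} (G : GenMatrix n k) (projective : Projective G) where

  ∣columnSet∩∣ : ∀ p → ∣ columnSet G ∩ p ∣ ≡ ∑ᶠ n (λ j → toℕ (p (column G j)))
  ∣columnSet∩∣ p = begin
    ∑ k (λ x → toℕ (anyᶠ (λ j → column G j == x) ∧ p x))
      ≡⟨ ∑-cong k (λ x → cong toℕ (anyᶠ-∧ʳ (λ j → column G j == x) (p x))) ⟨
    ∑ k (λ x → toℕ (anyᶠ (λ j → (column G j == x) ∧ p x)))    ≡⟨ ∑-cong k (λ x → toℕ-anyᶠ _ (unique x)) ⟩
    ∑ k (λ x → ∑ᶠ n (λ j → toℕ ((column G j == x) ∧ p x)))    ≡⟨ ∑ᶠ-∑-comm n k _ ⟨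
    ∑ᶠ n (λ j → ∣ ⁅ column G j ⁆ ∩ p ∣)                       ≡⟨ ∑ᶠ-cong n (λ j → ∣⁅⁆∩∣ (column G j) p) ⟩
    ∑ᶠ n (λ j → toℕ (p (column G j)))                         ∎
    where
    open ≡-Reasoning
    unique : ∀ x i j → (column G i == x) ∧ p x ≡ true → (column G j == x) ∧ p x ≡ true → i ≡ j
    unique x i j i∈ j∈ = column-injective G projective i j
      (trans (==⇒≡ (∧-conicalˡ _ _ i∈)) (sym (==⇒≡ (∧-conicalˡ _ _ j∈))))

  ∣columnSet∣ : ∣ columnSet G ∣ ≡ n
  ∣columnSet∣ = trans (∣∣-cong (λ x → sym (∧-identityʳ (columnSet G x))))
                      (trans (∣columnSet∩∣ full) (∑ᶠ-one n))

  0∉columnSet : columnSet G 0ᵛ ≡ false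
  0∉columnSet = ¬-not λ 0∈G → let j , cⱼ≡0 = columnSet⇒column G 0∈G in proj₁ projective j cⱼ≡0

  weight-encode : ∀ m → weight (encode G m) ≡ ∣ columnSet G ∩ (m ·_) ∣
  weight-encode m = trans (weight-tabulate (λ j → m · column G j)) (sym (∣columnSet∩∣ (m ·_)))

  twoDivisible⇔sumOf≡0ᵛ : TwoDivisible G ⇔ sumOf (columnSet G) ≡ 0ᵛ
  twoDivisible⇔sumOf≡0ᵛ = mk⇔
    (λ twoDivisible → ·≡false⇒≡0ᵛ _ λ m → trans (sym (odd-weight m)) (2∣⇒¬odd (twoDivisible m)))
    (λ Σ≡0 m → ¬odd⇒2∣ _ (trans (odd-weight m) (trans (cong (m ·_) Σ≡0) (·-zeroʳ m))))
    where
    odd-weight : ∀ m → odd (weight (encode G m)) ≡ m · sumOf (columnSet G)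
    odd-weight m = trans (cong odd (weight-encode m)) (sym (·-sumOf m (columnSet G)))

true⇔true⇒≡ : ∀ {a b} → (a ≡ true → b ≡ true) → (b ≡ true → a ≡ true) → a ≡ b
true⇔true⇒≡ {true}          a⇒b _   = sym (a⇒b refl)
true⇔true⇒≡ {false} {true}  _   b⇒a = b⇒a refl
true⇔true⇒≡ {false} {false} _   _   = refl

module _ {k} (χ : Subset k) where

  private
    G : GenMatrix ∣ χ ∣ k
    G = fromColumns (elements χ)

  columnSet-fromElements : columnSet G ≗ χ
  columnSet-fromElements x = true⇔true⇒≡ sound complete
    where
    sound : columnSet G x ≡ true → χ x ≡ true
    sound x∈G = let j , cⱼ≡x = columnSet⇒column G x∈G in
      subst (λ y → χ y ≡ true) (trans (sym (column-fromColumns _ j)) cⱼ≡x) (All.lookup⁺ (elements-sound χ) j)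
    complete : χ x ≡ true → columnSet G x ≡ true
    complete x∈χ = let x∈ = elements-complete χ x∈χ in
      subst (λ y → columnSet G y ≡ true) (trans (column-fromColumns _ (index x∈)) (sym (lookup-index x∈)))
            (column∈columnSet G (index x∈))

  projective-fromElements : χ 0ᵛ ≡ false → Projective G
  projective-fromElements 0∉χ = nonzero-columns , distinct-columns
    where
    nonzero-columns : ∀ j → column G j ≢ 0ᵛ
    nonzero-columns j cⱼ≡0 = case trans (sym (All.lookup⁺ (elements-sound χ) j))
                               (trans (cong χ (trans (sym (column-fromColumns _ j)) cⱼ≡0)) 0∉χ) of λ ()
    distinct-columns : ∀ i j → i ≢ j → column G i ≢ column G j
    distinct-columns i j i≢j cᵢ≡cⱼ = i≢j (Unique.lookup-injective (elements-unique χ) i j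
      (trans (sym (column-fromColumns _ i)) (trans cᵢ≡cⱼ (column-fromColumns _ j))))

ExistsPD⇔SpanningSet : ∀ n k → ExistsPD n k ⇔ SpanningSet k n 0ᵛ
ExistsPD⇔SpanningSet n k = mk⇔ pd⇒set set⇒pd
  where
  open Equivalence
  pd⇒set : ExistsPD n k → SpanningSet k n 0ᵛ
  pd⇒set (G , fullRank , projective , twoDivisible) = record
    { base     = record { points = columnSet G
                        ; size   = ∣columnSet∣ G projective
                        ; sum    = to (twoDivisible⇔sumOf≡0ᵛ G projective) twoDivisible }
    ; 0∉       = 0∉columnSet G projective
    ; spanning = to (fullRank⇔spanning G) fullRank
    }
  set⇒pd : SpanningSet k n 0ᵛ → ExistsPD n k
  set⇒pd P = subst (λ n → ExistsPD n k) (size (base P)) (G , fullRank , projective , twoDivisible)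
    where
    χ = points (base P)
    G = fromColumns (elements χ)
    projective = projective-fromElements χ (0∉ P)
    fullRank : FullRank G
    fullRank = from (fullRank⇔spanning G) λ m m⊥ →
      spanning P m (λ x x∈χ → m⊥ x (trans (columnSet-fromElements χ x) x∈χ))
    twoDivisible : TwoDivisible G
    twoDivisible = from (twoDivisible⇔sumOf≡0ᵛ G projective) (trans (sumOf-cong (columnSet-fromElements χ)) (sum (base P)))

insert-0ᵛ : ∀ {k n} (A : SumSet k n 0ᵛ) → points A 0ᵛ ≡ false → SumSet k (1 + n) 0ᵛ
insert-0ᵛ A 0∉A =
  castˢ refl (⊕-self 0ᵛ) (∪ˢ ⁅ 0ᵛ ⁆ˢ A (λ x 0ᵛ≡x → trans (cong (points A) (sym (==⇒≡ 0ᵛ≡x))) 0∉A))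

zeroSum-0∉⇒< : ∀ {k n} (A : SumSet k n 0ᵛ) → points A 0ᵛ ≡ false → n < 2 ^ k
zeroSum-0∉⇒< {k} A 0∉A = subst (_≤ 2 ^ k) (size A∪⁅0ᵛ⁆) (∣∣≤2^ (points A∪⁅0ᵛ⁆))
  where A∪⁅0ᵛ⁆ = insert-0ᵛ A 0∉A

zeroSum-0∉⇒≢ : ∀ {j n} (A : SumSet (2 + j) n 0ᵛ) → points A 0ᵛ ≡ false →
               (2 + n ≢ 2 ^ (2 + j)) × (3 + n ≢ 2 ^ (2 + j))
zeroSum-0∉⇒≢ {j} {n} A 0∉A = n+2≢2^k , n+3≢2^k
  where
  R : ∀ q → (1 + n) + q ≡ 2 ^ (2 + j) → SumSet (2 + j) q 0ᵛ
  R q = ∁ˢ (insert-0ᵛ A 0∉A)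
  n+2≢2^k : 2 + n ≢ 2 ^ (2 + j)
  n+2≢2^k n+2≡2^k =
    ∣∣≡1⇒sumOf≢0ᵛ (points R₁) (cong (λ b → not (b ∨ points A 0ᵛ)) (==-refl (0ᵛ {2 + j}))) (size R₁) (sum R₁)
    where R₁ = R 1 (trans (cong suc (+-comm n 1)) n+2≡2^k)
  n+3≢2^k : 3 + n ≢ 2 ^ (2 + j)
  n+3≢2^k n+3≡2^k = ∣∣≡2⇒sumOf≢0ᵛ (points R₂) (size R₂) (sum R₂)
    where R₂ = R 2 (trans (cong suc (+-comm n 2)) n+3≡2^k)

cube-injection⇒≤ : ∀ a b (φ : Vec Bool a → Vec Bool b) → (∀ x y → φ x ≡ φ y → x ≡ y) → a ≤ b
cube-injection⇒≤ a b φ φ-injective = ≮⇒≥ λ b<a → <⇒≱ (^-monoʳ-< 2 (s≤s (s≤s z≤n)) b<a) (begin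
  2 ^ a                                    ≡⟨ ∑-one a ⟨
  ∑ a (λ _ → 1)                            ≡⟨ ∑-cong a (λ x → ∣⁅⁆∣ (φ x)) ⟨
  ∑ a (λ x → ∑ b (λ y → toℕ (φ x == y)))   ≡⟨ ∑-comm a b _ ⟩
  ∑ b (λ y → ∣ (λ x → φ x == y) ∣)         ≤⟨ ∑-mono-≤ b (λ y → ∣∣≤1 _ (fibre-unique y)) ⟩
  ∑ b (λ _ → 1)                            ≡⟨ ∑-one b ⟩
  2 ^ b                                    ∎)
  where
  open ≤-Reasoning
  fibre-unique : ∀ y x x′ → (φ x == y) ≡ true → (φ x′ == y) ≡ true → x ≡ x′
  fibre-unique y x x′ φx≡y φx′≡y = φ-injective x x′ (trans (==⇒≡ φx≡y) (sym (==⇒≡ φx′≡y)))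

encode-injective : ∀ {n k} (G : GenMatrix n k) → FullRank G → ∀ m m′ → encode G m ≡ encode G m′ → m ≡ m′
encode-injective {n} G fullRank m m′ mG≡m′G = ⊕≡0ᵛ⇒≡ m m′ (fullRank (m ⊕ m′) (vec-ext λ j → begin
  lookup (encode G (m ⊕ m′)) j                       ≡⟨ lookup-encode G (m ⊕ m′) j ⟩
  (m ⊕ m′) · column G j                              ≡⟨ ·-distribˡ-⊕ m m′ (column G j) ⟩
  m · column G j xor m′ · column G j                 ≡⟨ cong₂ _xor_ (lookup-encode G m j) (lookup-encode G m′ j) ⟨
  lookup (encode G m) j xor lookup (encode G m′) j   ≡⟨ cong (λ v → lookup v j xor lookup (encode G m′) j) mG≡m′G ⟩
  lookup (encode G m′) j xor lookup (encode G m′) j  ≡⟨ xor-same (lookup (encode G m′) j) ⟩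
  false                                              ≡⟨ lookup-replicate j false ⟨
  lookup (replicate n false) j                       ∎))
  where open ≡-Reasoning

≡-parity-tail⇒≡ : ∀ {n} (u v : Vec Bool (suc n)) → odd (weight u) ≡ odd (weight v) → tail u ≡ tail v → u ≡ v
≡-parity-tail⇒≡ (true  ∷ t) (true  ∷ .t) _ refl = refl
≡-parity-tail⇒≡ (false ∷ t) (false ∷ .t) _ refl = refl
≡-parity-tail⇒≡ (true  ∷ t) (false ∷ .t) e refl = ⊥-elim (not-¬ refl (sym e))
≡-parity-tail⇒≡ (false ∷ t) (true  ∷ .t) e refl = ⊥-elim (not-¬ refl e)

length>dimension : ∀ {n k} (G : GenMatrix n k) → 1 ≤ n → FullRank G → TwoDivisible G → k + 1 ≤ n
length>dimension {suc n} {k} G _ fullRank twoDivisible =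
  subst (_≤ suc n) (+-comm 1 k) (s≤s (cube-injection⇒≤ k n (tail ∘ encode G) tail-injective))
  where
  tail-injective : ∀ x y → tail (encode G x) ≡ tail (encode G y) → x ≡ y
  tail-injective x y tails≡ = encode-injective G fullRank x y (≡-parity-tail⇒≡ _ _
    (trans (2∣⇒¬odd (twoDivisible x)) (sym (2∣⇒¬odd (twoDivisible y)))) tails≡)

theorem5 : ∀ (n k : ℕ) → 1 ≤ n → 1 ≤ k →
    ExistsPD n k ⇔ (k + 1 ≤ n × n ≤ 2 ^ k ∸ 1 × n ≢ 2 ^ k ∸ 3 × n ≢ 2 ^ k ∸ 2)
theorem5 n k 1≤n 1≤k = mk⇔ necessary sufficient
  where
  open Equivalence (ExistsPD⇔SpanningSet n k)

  excluded : ∀ k → 1 ≤ k → SpanningSet k n 0ᵛ → n ≢ 2 ^ k ∸ 3 × n ≢ 2 ^ k ∸ 2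
  excluded 1 _ _ = (λ { refl → <⇒≱ 1≤n z≤n }) , (λ { refl → <⇒≱ 1≤n z≤n })
  excluded (suc (suc j)) _ P =
    let n+2≢2^k , n+3≢2^k = zeroSum-0∉⇒≢ (base P) (0∉ P)
    in +≢⇒≢∸ (≤-trans (s≤s (s≤s (s≤s z≤n))) 4≤2^k) n+3≢2^k ,
       +≢⇒≢∸ (≤-trans (s≤s (s≤s z≤n)) 4≤2^k) n+2≢2^k
    where 4≤2^k = ^-monoʳ-≤ 2 (m≤m+n 2 j)

  necessary : ExistsPD n k → k + 1 ≤ n × n ≤ 2 ^ k ∸ 1 × n ≢ 2 ^ k ∸ 3 × n ≢ 2 ^ k ∸ 2
  necessary pd@(G , fullRank , _ , twoDivisible) =
    length>dimension G 1≤n fullRank twoDivisible , <⇒≤∸1 (zeroSum-0∉⇒< (base P) (0∉ P)) , excluded k 1≤k P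
    where P = to pd

  sufficient : k + 1 ≤ n × n ≤ 2 ^ k ∸ 1 × n ≢ 2 ^ k ∸ 3 × n ≢ 2 ^ k ∸ 2 → ExistsPD n k
  sufficient (k+1≤n , n≤2^k∸1 , n≢2^k∸3 , n≢2^k∸2) =
    from (spanningSet-exists k n k+1≤n (≤∸1⇒< (m^n>0 2 k) n≤2^k∸1) (≢∸⇒+≢ n≢2^k∸2) (≢∸⇒+≢ n≢2^k∸3))
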